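{- Let $\mathfrak G=(X,1,\curlywedge,s,A)$ be a general selection L-frame. Then $\mathfrak G$ validates $p\wedge(p\Rightarrow\bot)\trianglelefteq\bot$ iff for all $x\in X$ and $a\in A$, if $x\in a$ and $s(x,a)=\{1\}$ then $x=1$; and $\mathfrak G$ validates $p\wedge(p\Rightarrow q)\trianglelefteq q$ iff for all $x\in X$ and $a,b\in A$, if $x\in a$ and $s(x,a)\subseteq b$ then $x\in b$. Moreover, if $\mathfrak G$ is full or descriptive, then it validates $p\wedge(p\Rightarrow q)\trianglelefteq q$ iff for all $x\in X$ and $a\in A$, $x\in a$ implies $x\in s(x,a)$.
   Context: Meet-semilattice $(X,1,\curlywedge)$, $x\preccurlyeq y$ iff $x\curlywedge y=x$; filters are upward closed subsets closed under finite meets; $\mathcal F(X)$ the filters; $p\sqcup q:={\uparrow}\{x\curlywedge y:x\in p,y\in q\}$. A general selection L-frame is $(X,1,\curlywedge,s,A)$ where $A\subseteq\mathcal F(X)$ contains $X$ and $\{1\}$ and is closed under $\cap$, $\sqcup$ and $a\Rightarrow b:=\{x:s(x,a)\subseteq b\}$, and $s:X\times A\to\mathcal F(X)$ satisfies for $a\in A$: $s(1,a)=\{1\}$; $x\preccurlyeq y$ implies $s(y,a)\subseteq s(x,a)$; if $z\in s(x\curlywedge y,a)$ there are $u\in s(x,a)$, $v\in s(y,a)$ with $u\curlywedge v\preccurlyeq z$. Formulas $\phi::=p\mid\top\mid\bot\mid\phi\wedge\phi\mid\phi\vee\phi\mid\phi\Rightarrow\phi$ are interpreted under admissible valuations $V$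 (letters to $A$): $x\Vdash p$ iff $x\in V(p)$; $\top$ always; $x\Vdash\bot$ iff $x=1$; $\wedge$ pointwise; $x\Vdash\phi\vee\psi$ iff some $y\Vdash\phi$, $z\Vdash\psi$ have $y\curlywedge z\preccurlyeq x$; $x\Vdash\phi\Rightarrow\psi$ iff $s(x,[\![\phi]\!])\subseteq[\![\psi]\!]$. Validity of $\phi\trianglelefteq\psi$: $[\![\phi]\!]\subseteq[\![\psi]\!]$ under every admissible valuation. $\mathfrak G$ is full if $A=\mathcal F(X)$; descriptive if there is a topology $\tau$ on $X$ with $(X,\tau)$ compact, $A$ equal to the set of clopen filters, clopen filters closed under $\sqcup$, HMS separation (if $x\not\preccurlyeq y$ some clopen filter contains $x$ but not $y$), each $s(x,a)$ a closed filter, and $a\Rightarrow b$ clopen for clopen filters $a,b$. -}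

module Defs where

open import Level using (0ℓ)
open import Data.Nat using (ℕ)
open import Data.Unit using (⊤; tt)
open import Data.Empty using (⊥)
open import Data.Product using (Σ; ∃; ∃-syntax; _×_; _,_)
open import Data.List using (List)
open import Data.List.Relation.Unary.Any using (Any)
open import Relation.Nullary using (¬_)
open import Relation.Unary using (Pred; _⊆_; _∈_; _∉_; _∩_)
open import Relation.Binary.PropositionalEquality using (_≡_)
open import Algebra.Structures using (IsIdempotentCommutativeMonoid)
open import Function.Bundles using (_⇔_)

_≐_ : {X : Set} → Pred X 0ℓ → Pred X 0ℓ → Set
a ≐ b = (a ⊆ b) × (b ⊆ a)

module _ {X : Set} (one : X) (_⋏_ : X → X → X) where

  Below : X → X → Set
  Below x y = (x ⋏ y) ≡ x

  Single : Pred X 0ℓ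
  Single x = x ≡ one

  record IsFilter (F : Pred X 0ℓ) : Set where
    field
      has-one : one ∈ F
      up      : ∀ {x y} → x ∈ F → Below x y → y ∈ F
      meet    : ∀ {x y} → x ∈ F → y ∈ F → (x ⋏ y) ∈ F

  Join : Pred X 0ℓ → Pred X 0ℓ → Pred X 0ℓ
  Join p q z = ∃[ x ] ∃[ y ] (x ∈ p × y ∈ q × Below (x ⋏ y) z)

Arrow : {X : Set} → (X → Pred X 0ℓ → Pred X 0ℓ) → Pred X 0ℓ → Pred X 0ℓ → Pred X 0ℓ
Arrow s a b x = s x a ⊆ b

-- General selection L-frames  (X, 1, ⋏, s, A)
-- s is given as a function on all subsets, but only its values on
-- members of A are constrained (and ever used).

record GSLFrame : Set₁ where
  field
    X     : Set
    one   : X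
    _⋏_   : X → X → X
    isMeetSemilattice : IsIdempotentCommutativeMonoid _≡_ _⋏_ one
    A     : Pred X 0ℓ → Set
    s     : X → Pred X 0ℓ → Pred X 0ℓ
    A-resp   : ∀ {a b} → a ≐ b → A a → A b
    A-filter : ∀ {a} → A a → IsFilter one _⋏_ a
    A-X      : A (λ _ → ⊤)
    A-one    : A (Single one _⋏_)
    A-∩      : ∀ {a b} → A a → A b → A (a ∩ b)
    A-⊔      : ∀ {a b} → A a → A b → A (Join one _⋏_ a b)
    A-⇒      : ∀ {a b} → A a → A b → A (Arrow s a b)
    s-resp   : ∀ {x a b} → A a → a ≐ b → s x a ≐ s x b
    s-filter : ∀ {x a} → A a → IsFilter one _⋏_ (s x a)
    s-one    : ∀ {a} → A a → s one a ≐ Single one _⋏_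
    s-anti   : ∀ {x y a} → A a → Below one _⋏_ x y → s y a ⊆ s x a
    s-split  : ∀ {x y z a} → A a → z ∈ s (x ⋏ y) a →
               ∃[ u ] ∃[ v ] (u ∈ s x a × v ∈ s y a × Below one _⋏_ (u ⋏ v) z)

data Formula : Set where
  var  : ℕ → Formula
  top  : Formula
  bot  : Formula
  _∧ᶠ_ : Formula → Formula → Formula
  _∨ᶠ_ : Formula → Formula → Formula
  _⇒ᶠ_ : Formula → Formula → Formula

infixr 6 _∧ᶠ_
infixr 5 _∨ᶠ_
infixr 4 _⇒ᶠ_

module _ (G : GSLFrame) where
  open GSLFrame G

  Valuation : Set₁
  Valuation = ℕ → Pred X 0ℓ

  Admissible : Valuation → Set
  Admissible V = ∀ n → A (V n)

  ⟦_⟧ : Formula → Valuation → Pred X 0ℓ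
  ⟦ var n ⟧ V = V n
  ⟦ top ⟧ V = λ _ → ⊤
  ⟦ bot ⟧ V = Single one _⋏_
  ⟦ φ ∧ᶠ ψ ⟧ V = ⟦ φ ⟧ V ∩ ⟦ ψ ⟧ V
  ⟦ φ ∨ᶠ ψ ⟧ V = Join one _⋏_ (⟦ φ ⟧ V) (⟦ ψ ⟧ V)
  ⟦ φ ⇒ᶠ ψ ⟧ V = Arrow s (⟦ φ ⟧ V) (⟦ ψ ⟧ V)

  Validates : Formula → Formula → Set₁
  Validates φ ψ = ∀ V → Admissible V → ⟦ φ ⟧ V ⊆ ⟦ ψ ⟧ V

  Full : Set₁
  Full = ∀ a → IsFilter one _⋏_ a → A a

module _ {X : Set} where

  Compl : Pred X 0ℓ → Pred X 0ℓ
  Compl a x = ¬ (a x)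

  Union : {I : Set} → (I → Pred X 0ℓ) → Pred X 0ℓ
  Union {I} U x = Σ I (λ i → U i x)

  record IsTopology (τ : Pred X 0ℓ → Set) : Set₁ where
    field
      resp  : ∀ {a b} → a ≐ b → τ a → τ b
      whole : τ (λ _ → ⊤)
      inter : ∀ {a b} → τ a → τ b → τ (a ∩ b)
      union : ∀ {I : Set} (U : I → Pred X 0ℓ) → (∀ i → τ (U i)) → τ (Union U)

  Closed : (τ : Pred X 0ℓ → Set) → Pred X 0ℓ → Set
  Closed τ a = τ (Compl a)

  Clopen : (τ : Pred X 0ℓ → Set) → Pred X 0ℓ → Set
  Clopen τ a = τ a × Closed τ a

  Compact : (τ : Pred X 0ℓ → Set) → Set₁
  Compact τ = ∀ {I : Set} (U : I → Pred X 0ℓ) → (∀ i → τ (U i)) →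
              (∀ x → x ∈ Union U) →
              ∃[ is ] (∀ x → Any (λ i → x ∈ U i) is)

record Descriptive (G : GSLFrame) : Set₁ where
  open GSLFrame G
  field
    τ        : Pred X 0ℓ → Set
    topology : IsTopology τ
    compact  : Compact τ
    A-clopen-filters : ∀ a → A a ⇔ (Clopen τ a × IsFilter one _⋏_ a)
    clopen-filters-⊔ : ∀ a b → Clopen τ a → IsFilter one _⋏_ a →
                       Clopen τ b → IsFilter one _⋏_ b →
                       Clopen τ (Join one _⋏_ a b)
    HMS      : ∀ x y → ¬ Below one _⋏_ x y →
               ∃[ c ] (Clopen τ c × IsFilter one _⋏_ c × x ∈ c × y ∉ c)
    s-closed : ∀ x a → A a → Closed τ (s x a)
    ⇒-clopen : ∀ a b → Clopen τ a → IsFilter one _⋏_ a →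
               Clopen τ b → IsFilter one _⋏_ b → Clopen τ (Arrow s a b)

-- Modus ponens is valid exactly when x ∈ a and s(x,a) ⊆ b force x ∈ b, for
-- admissible a, b.  Taking b = s(x,a) turns this into x ∈ s(x,a) as soon as
-- s(x,a) is itself admissible, which is the full case.  In the descriptive
-- case s(x,a) is only a closed filter; but if x ∉ s(x,a), then HMS separation
-- and compactness give a single clopen filter b ⊇ s(x,a) missing x, so the
-- hypothesis still applies.
module Submission where

open import Defs
open import Level using (0ℓ)
open import Data.Nat using (zero; suc)
open import Data.Unit using (⊤; tt)
open import Data.Empty using (⊥-elim)
open import Data.Product using (_×_; _,_; proj₁; proj₂; ∃-syntax)
open import Data.Sum using (_⊎_; inj₁; inj₂; [_,_])
open import Data.List using (List; []; _∷_)
open import Data.List.Relation.Unary.Any using (Any; here; there)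
import Data.List.Relation.Unary.Any as Any
open import Relation.Nullary using (¬_; yes; no)
open import Relation.Unary using (Pred; _⊆_; _∈_; _∉_)
open import Relation.Binary.PropositionalEquality using (_≡_; refl; cong; sym; module ≡-Reasoning)
open import Function.Bundles using (_⇔_; mk⇔; Equivalence)
open import Algebra.Structures using (IsIdempotentCommutativeMonoid)
open import Axiom.ExcludedMiddle using (ExcludedMiddle)
open import Axiom.DoubleNegationElimination using (em⇒dne)

module MeetSemilattice {X : Set} {one : X} {_⋏_ : X → X → X}
  (isMeetSemilattice : IsIdempotentCommutativeMonoid _≡_ _⋏_ one) where

  open IsIdempotentCommutativeMonoid isMeetSemilattice using (assoc; comm; idem)
  open ≡-Reasoning

  ⋏-lowerˡ : ∀ x y → Below one _⋏_ (x ⋏ y) x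
  ⋏-lowerˡ x y = begin
    (x ⋏ y) ⋏ x   ≡⟨ assoc x y x ⟩
    x ⋏ (y ⋏ x)   ≡⟨ cong (x ⋏_) (comm y x) ⟩
    x ⋏ (x ⋏ y)   ≡⟨ sym (assoc x x y) ⟩
    (x ⋏ x) ⋏ y   ≡⟨ cong (_⋏ y) (idem x) ⟩
    x ⋏ y         ∎

  ⋏-lowerʳ : ∀ x y → Below one _⋏_ (x ⋏ y) y
  ⋏-lowerʳ x y = begin
    (x ⋏ y) ⋏ y   ≡⟨ assoc x y y ⟩
    x ⋏ (y ⋏ y)   ≡⟨ cong (x ⋏_) (idem y) ⟩
    x ⋏ y         ∎

  Single⊆filter : ∀ {F} → IsFilter one _⋏_ F → Single one _⋏_ ⊆ F
  Single⊆filter fF refl = IsFilter.has-one fF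

  -- Each U i need only be upward closed along F; this lets the complement
  -- of F occur in the cover.
  filter⊆one-of-finite-cover : ExcludedMiddle 0ℓ →
    ∀ {F} → IsFilter one _⋏_ F → {I : Set} (U : I → Pred X 0ℓ) →
    (∀ i {u w} → F u → U i u → Below one _⋏_ u w → U i w) →
    (is : List I) → (∀ {z} → F z → Any (λ i → U i z) is) →
    ∃[ i ] (F ⊆ U i)
  filter⊆one-of-finite-cover em fF U up [] cover
    with () ← cover (IsFilter.has-one fF)
  filter⊆one-of-finite-cover em {F} fF U up (i ∷ is) cover
    with em {∃[ z₀ ] (F z₀ × ¬ U i z₀)}
  ... | no ∄z₀ = i , λ {z} Fz → em⇒dne em (λ ¬Uiz → ∄z₀ (z , Fz , ¬Uiz))
  ... | yes (z₀ , Fz₀ , ¬Uiz₀) = filter⊆one-of-finite-cover em fF U up is cover′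
    where
    -- z ⋏ z₀ ∈ F is covered, but not by U i, since U i would then contain z₀.
    cover′ : ∀ {z} → F z → Any (λ j → U j z) is
    cover′ {z} Fz = drop-i (cover Fz⋏z₀)
      where
      Fz⋏z₀ : F (z ⋏ z₀)
      Fz⋏z₀ = IsFilter.meet fF Fz Fz₀

      drop-i : Any (λ j → U j (z ⋏ z₀)) (i ∷ is) → Any (λ j → U j z) is
      drop-i (here Ui[z⋏z₀]) = ⊥-elim (¬Uiz₀ (up i Fz⋏z₀ Ui[z⋏z₀] (⋏-lowerʳ z z₀)))
      drop-i (there covered) = Any.map (λ {j} Uj → up j Fz⋏z₀ Uj (⋏-lowerˡ z z₀)) covered

module _ (G : GSLFrame) where
  open GSLFrame G
  open MeetSemilattice isMeetSemilattice

  valuation : Pred X 0ℓ → Pred X 0ℓ → Valuation G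
  valuation a b zero    = a
  valuation a b (suc _) = b

  valuation-admissible : ∀ {a b} → A a → A b → Admissible G (valuation a b)
  valuation-admissible Aa Ab zero    = Aa
  valuation-admissible Aa Ab (suc _) = Ab

  ModusPonensCondition : Set₁
  ModusPonensCondition = ∀ x a b → A a → A b → a x → s x a ⊆ b → b x

  Reflexive : Set₁
  Reflexive = ∀ x a → A a → a x → s x a x

  validates-absurdity⇔ :
    Validates G (var 0 ∧ᶠ (var 0 ⇒ᶠ bot)) bot ⇔
    (∀ x a → A a → a x → s x a ≐ Single one _⋏_ → x ≡ one)
  validates-absurdity⇔ = mk⇔
    (λ valid x a Aa ax sxa≐1 →
      valid (valuation a a) (valuation-admissible Aa Aa) (ax , proj₁ sxa≐1))
    (λ cond V admissible {x} (x∈V0 , sx⊆1) →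
      cond x (V 0) (admissible 0) x∈V0 (sx⊆1 , Single⊆filter (s-filter (admissible 0))))

  validates-modusPonens⇔ :
    Validates G (var 0 ∧ᶠ (var 0 ⇒ᶠ var 1)) (var 1) ⇔ ModusPonensCondition
  validates-modusPonens⇔ = mk⇔
    (λ valid x a b Aa Ab ax sxa⊆b →
      valid (valuation a b) (valuation-admissible Aa Ab) (ax , sxa⊆b))
    (λ cond V admissible {x} (x∈V0 , sx⊆V1) →
      cond x (V 0) (V 1) (admissible 0) (admissible 1) x∈V0 sx⊆V1)

  reflexive⇒modusPonensCondition : Reflexive → ModusPonensCondition
  reflexive⇒modusPonensCondition reflexive x a b Aa Ab ax sxa⊆b = sxa⊆b (reflexive x a Aa ax)

  full-modusPonensCondition⇒reflexive : Full G → ModusPonensCondition → Reflexive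
  full-modusPonensCondition⇒reflexive full cond x a Aa ax =
    cond x a (s x a) Aa (full _ (s-filter Aa)) ax (λ sxa → sxa)

  module _ (em : ExcludedMiddle 0ℓ) (D : Descriptive G) where
    open Descriptive D

    clopen-filter-admissible : ∀ {c} → Clopen τ c → IsFilter one _⋏_ c → A c
    clopen-filter-admissible {c} clopen fc =
      Equivalence.from (A-clopen-filters c) (clopen , fc)

    -- Cover X by the complement of F and, for each y ∈ F, an HMS clopen filter
    -- containing y but not x; a finite subcover then puts F inside one of them.
    closed-filter-separation : ∀ {F x} → Closed τ F → IsFilter one _⋏_ F → x ∉ F →
      ∃[ c ] (A c × F ⊆ c × x ∉ c)
    closed-filter-separation {F} {x} closedF fF x∉F =
      separated (filter⊆one-of-finite-cover em fF U U-up finite covers)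
      where
      separator : ∀ {y} → F y → ∃[ c ] (Clopen τ c × IsFilter one _⋏_ c × y ∈ c × x ∉ c)
      separator {y} Fy = HMS y x (λ y≼x → x∉F (IsFilter.up fF Fy y≼x))

      U : ⊤ ⊎ ∃[ y ] F y → Pred X 0ℓ
      U (inj₁ _)        = Compl F
      U (inj₂ (_ , Fy)) = proj₁ (separator Fy)

      U-open : ∀ i → τ (U i)
      U-open (inj₁ _)        = closedF
      U-open (inj₂ (_ , Fy)) = let (_ , (open-c , _) , _) = separator Fy in open-c

      U-covers : ∀ z → Union U z
      U-covers z with em {F z}
      ... | yes Fz = inj₂ (z , Fz) , let (_ , _ , _ , z∈c , _) = separator Fz in z∈c
      ... | no ¬Fz = inj₁ tt , ¬Fz

      U-up : ∀ i {u w} → F u → U i u → Below one _⋏_ u w → U i w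
      U-up (inj₁ _)        Fu ¬Fu _   = ⊥-elim (¬Fu Fu)
      U-up (inj₂ (_ , Fy)) _  Uu  u≼w =
        let (_ , _ , fc , _) = separator Fy in IsFilter.up fc Uu u≼w

      finite : List (⊤ ⊎ ∃[ y ] F y)
      finite = proj₁ (compact U U-open U-covers)

      covers : ∀ {z} → F z → Any (λ i → U i z) finite
      covers {z} _ = proj₂ (compact U U-open U-covers) z

      separated : ∃[ i ] (F ⊆ U i) → ∃[ c ] (A c × F ⊆ c × x ∉ c)
      separated (inj₁ _ , F⊆∁F) = ⊥-elim (F⊆∁F (IsFilter.has-one fF) (IsFilter.has-one fF))
      separated (inj₂ (_ , Fy) , F⊆c) =
        let (c , clopen , fc , _ , x∉c) = separator Fy
        in c , clopen-filter-admissible clopen fc , F⊆c , x∉c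

  descriptive-modusPonensCondition⇒reflexive :
    ExcludedMiddle 0ℓ → Descriptive G → ModusPonensCondition → Reflexive
  descriptive-modusPonensCondition⇒reflexive em D cond x a Aa ax =
    em⇒dne em λ x∉sxa →
      let (c , Ac , sxa⊆c , x∉c) =
            closed-filter-separation em D (s-closed x a Aa) (s-filter Aa) x∉sxa
      in x∉c (cond x a c Aa Ac ax sxa⊆c)
    where open Descriptive D

  validates-modusPonens⇔reflexive : ExcludedMiddle 0ℓ → Full G ⊎ Descriptive G →
    Validates G (var 0 ∧ᶠ (var 0 ⇒ᶠ var 1)) (var 1) ⇔ Reflexive
  validates-modusPonens⇔reflexive em fullOrDescriptive = mk⇔
    (λ valid → modusPonensCondition⇒reflexive (Equivalence.to validates-modusPonens⇔ valid))
    (λ reflexive → Equivalence.from validates-modusPonens⇔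
                     (reflexive⇒modusPonensCondition reflexive))
    where
    modusPonensCondition⇒reflexive : ModusPonensCondition → Reflexive
    modusPonensCondition⇒reflexive =
      [ full-modusPonensCondition⇒reflexive
      , descriptive-modusPonensCondition⇒reflexive em ] fullOrDescriptive

proposition5p13 : (G : GSLFrame) →
    (Validates G (var 0 ∧ᶠ (var 0 ⇒ᶠ bot)) bot ⇔
      (∀ x a → GSLFrame.A G a → a x →
        GSLFrame.s G x a ≐ Single (GSLFrame.one G) (GSLFrame._⋏_ G) → x ≡ GSLFrame.one G))
    × (Validates G (var 0 ∧ᶠ (var 0 ⇒ᶠ var 1)) (var 1) ⇔
      (∀ x a b → GSLFrame.A G a → GSLFrame.A G b → a x → GSLFrame.s G x a ⊆ b → b x))
    × (ExcludedMiddle 0ℓ → Full G ⊎ Descriptive G →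
      (Validates G (var 0 ∧ᶠ (var 0 ⇒ᶠ var 1)) (var 1) ⇔
        (∀ x a → GSLFrame.A G a → a x → GSLFrame.s G x a x)))
proposition5p13 G =
  validates-absurdity⇔ G , validates-modusPonens⇔ G , validates-modusPonens⇔reflexive G
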